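{- If $D$ is a $\%$-avoiding diagram that is not northwest, then $\operatorname{ch}(\mathcal{S}^\flat_D)\neq\mathfrak{K}_D$.
   Context: A diagram is a finite set of cells $(i,j)\in\mathbb{Z}_{>0}\times\mathbb{Z}_{>0}$ ($i$ row, $j$ column), rows numbered top to bottom. $D$ is northwest if whenever $(j,k),(i,l)\in D$ with $i<j$, $k<l$, then $(i,k)\in D$. $D$ is $\%$-avoiding if whenever $(j,k),(i,l)\in D$ with $i<j$, $k<l$, then $(i,k)\in D$ or $(j,l)\in D$. A Kohnert move selects the rightmost cell of some row and moves it up (toward row 1) within its column to the first empty position above it, jumping over occupied positions, if one exists; $\mathrm{KD}(D)$ is the set of diagrams reachable from $D$ by sequences of Kohnert moves (including $D$). $\mathbf{wt}(T)$ is the weak composition whose $i$th part is the number of cells in row $i$; $\mathfrak{K}_D=\sum_{T\in\mathrm{KD}(D)}x^{\mathbf{wt}(T)}$. Flagged Schur module: fix $n\ge$ the largest row index of a cell of $D$. With indeterminates $z_{i,j}$, $GL_n$ acts on $\mathbb{C}[z_{i,j}]$ by algebra automorphisms $A\cdot z_{k,l}=\sum_{i\le n}A_{i,k}z_{i,l}$ ($k\le n$), $z_{k,l}$ fixed for $k>n$. For arrays $\mathbf{a},\mathbf{b}\in\mathbb{N}^m$, $(\mathbf{a}\mid\mathbf{b})=\det(z_{a_p,b_q})$. For a filling $T:D\to\{1,\dots,n\}$, $\Delta_T=\prod_j(T^{(j)}\mid D^{(j)})$ where $T^{(j)}$ lists the values of $T$ in column $j$ and $D^{(j)}$ the row indices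 of the cells of $D$ in column $j$ (both ordered by row). $\mathcal{S}_D=\mathrm{span}_\mathbb{C}\{\Delta_T\}$; $I=\langle z_{i,j}:i>j\rangle$; $\mathcal{S}^\flat_D=\mathcal{S}_D/(\mathcal{S}_D\cap I)$ as a module over upper triangular matrices, spanned by images of $\Delta_T$ for flagged $T$ (value at each cell of row $i$ at most $i$). $\operatorname{ch}(\mathcal{S}^\flat_D)$ is the trace of $\mathrm{diag}(x_1,\dots,x_n)$ acting on it. -}

module Defs where

open import Data.Bool using (Bool; true; false; if_then_else_; _∧_)
open import Data.Nat as ℕ using (ℕ; zero; suc)
open import Data.Fin as Fin using (Fin)
open import Data.Fin.Properties using () renaming (_≟_ to _≟F_)
open import Data.List as List using (List; []; _∷_; _++_; map; allFin; filterᵇ; length; foldr)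
open import Data.List.Relation.Unary.All using (All)
open import Data.List.Relation.Unary.Unique.Propositional using (Unique)
open import Data.List.Membership.Propositional using (_∈_)
open import Data.Vec as Vec using (Vec; lookup; tabulate; updateAt; _[_]≔_)
import Data.Vec.Properties as VecP
open import Data.Rational as ℚ using (ℚ; 0ℚ; 1ℚ)
open import Data.Product using (Σ; ∃; ∃-syntax; _×_; _,_)
open import Data.Sum using (_⊎_)
open import Relation.Binary.PropositionalEquality using (_≡_)
open import Relation.Nullary using (¬_; does)
open import Relation.Binary.Construct.Closure.ReflexiveTransitive using (Star)
open import Function.Bundles using (_⇔_)
open import Data.Nat.ListAction using (sum)

-- Row index r : Fin n stands for row
-- (toℕ r + 1), column c : Fin m for column (toℕ c + 1).  Every finite
-- diagram fits in such a box; n is also the n of GL_n (n ≥ largest row).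

Grid : ℕ → ℕ → Set
Grid n m = Vec (Vec Bool m) n

cell : ∀ {n m} → Grid n m → Fin n → Fin m → Bool
cell D r c = lookup (lookup D r) c

Northwest : ∀ {n m} → Grid n m → Set
Northwest {n} {m} D =
  (i j : Fin n) (k l : Fin m) → i Fin.< j → k Fin.< l →
  cell D j k ≡ true → cell D i l ≡ true → cell D i k ≡ true

PercentAvoiding : ∀ {n m} → Grid n m → Set
PercentAvoiding {n} {m} D =
  (i j : Fin n) (k l : Fin m) → i Fin.< j → k Fin.< l →
  cell D j k ≡ true → cell D i l ≡ true →
  (cell D i k ≡ true) ⊎ (cell D j l ≡ true)

setCell : ∀ {n m} → Grid n m → Fin n → Fin m → Bool → Grid n m
setCell D r c b = updateAt D r (λ row → row [ c ]≔ b)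

-- Move the rightmost cell (r,c) of row r up to the lowest empty
-- position (r',c) above it, jumping over the occupied ones in between.
KohnertMove : ∀ {n m} → Grid n m → Grid n m → Set
KohnertMove {n} {m} T T' =
  Σ (Fin n) λ r → Σ (Fin m) λ c → Σ (Fin n) λ r' →
    (cell T r c ≡ true) ×
    ((c' : Fin m) → c Fin.< c' → cell T r c' ≡ false) ×
    (r' Fin.< r) ×
    (cell T r' c ≡ false) ×
    ((r'' : Fin n) → r' Fin.< r'' → r'' Fin.< r → cell T r'' c ≡ true) ×
    (T' ≡ setCell (setCell T r c false) r' c true)

KD : ∀ {n m} → Grid n m → Grid n m → Set
KD D T = Star KohnertMove D T

sumFin : ∀ {k} → (Fin k → ℕ) → ℕ
sumFin {k} f = sum (map f (allFin k))

b2n : Bool → ℕ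
b2n true = 1
b2n false = 0

wt : ∀ {n m} → Grid n m → Vec ℕ n
wt {n} {m} T = tabulate λ r → sumFin {m} λ c → b2n (cell T r c)

-- coefficient of x^α in 𝔎_D is k
KohnertCoeff : ∀ {n m} → Grid n m → Vec ℕ n → ℕ → Set
KohnertCoeff {n} {m} D α k =
  Σ (List (Grid n m)) λ L →
    Unique L × ((T : Grid n m) → (T ∈ L) ⇔ (KD D T × wt T ≡ α)) × length L ≡ k

-- Polynomials over ℚ in the variables z_{a,b}, a,b ∈ {1..n}, as formal
-- sums of terms (coefficient, exponent matrix).

Mono : ℕ → Set
Mono n = Vec (Vec ℕ n) n

Poly : ℕ → Set
Poly n = List (ℚ × Mono n)

monoOne : ∀ {n} → Mono n
monoOne = tabulate λ _ → tabulate λ _ → 0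

monoMul : ∀ {n} → Mono n → Mono n → Mono n
monoMul x y = Vec.zipWith (Vec.zipWith ℕ._+_) x y

pzero : ∀ {n} → Poly n
pzero = []

pone : ∀ {n} → Poly n
pone = (1ℚ , monoOne) ∷ []

padd : ∀ {n} → Poly n → Poly n → Poly n
padd = _++_

pscale : ∀ {n} → ℚ → Poly n → Poly n
pscale q p = map (λ { (c , x) → (q ℚ.* c , x) }) p

pneg : ∀ {n} → Poly n → Poly n
pneg = pscale (ℚ.- 1ℚ)

pmul : ∀ {n} → Poly n → Poly n → Poly n
pmul p q = List.concatMap (λ { (c , x) → map (λ { (d , y) → (c ℚ.* d , monoMul x y) }) q }) p

coeff : ∀ {n} → Poly n → Mono n → ℚ
coeff p x = foldr (λ { (c , y) acc →
  if does (VecP.≡-dec (VecP.≡-dec ℕ._≟_) y x) then c ℚ.+ acc else acc }) 0ℚ p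

-- the image of z_{a,b} in ℂ[z]/I, I = ⟨ z_{i,j} : i > j ⟩:
-- z_{a,b} itself if a ≤ b, and 0 if a > b.
zvarI : ∀ {n} → Fin n → Fin n → Poly n
zvarI {n} a b with does (b Fin.<? a)
... | true  = pzero
... | false = (1ℚ , tabulate (λ i → tabulate (λ j →
                 if does (i ≟F a) ∧ does (j ≟F b) then 1 else 0))) ∷ []

minors : ∀ {B : Set} → List B → List (B × List B)
minors [] = []
minors (b ∷ bs) = (b , bs) ∷ map (λ { (x , r) → (x , b ∷ r) }) (minors bs)

altSum : ∀ {n} → List (Poly n) → Poly n
altSum [] = pzero
altSum (p ∷ ps) = padd p (pneg (altSum ps))

-- (a | b) = det (z_{a_p, b_q}) modulo I (Laplace expansion along the
-- first row); used only with lists of equal length.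
detI : ∀ {n} → List (Fin n) → List (Fin n) → Poly n
detI [] bs = pone
detI (a ∷ as) bs = altSum (map (λ { (b , r) → pmul (zvarI a b) (detI as r) }) (minors bs))

pprod : ∀ {n} → List (Poly n) → Poly n
pprod = foldr pmul pone

-- fillings T : D → {1..n} (values outside D are irrelevant)
Filling : ℕ → ℕ → Set
Filling n m = Fin n → Fin m → Fin n

colRows : ∀ {n m} → Grid n m → Fin m → List (Fin n)
colRows {n} D c = filterᵇ (λ r → cell D r c) (allFin n)

ΔI : ∀ {n m} → Grid n m → Filling n m → Poly n
ΔI {n} {m} D T = pprod (map (λ c → detI (map (λ r → T r c) (colRows D c)) (colRows D c)) (allFin m))

content : ∀ {n m} → Grid n m → Filling n m → Vec ℕ n
content {n} {m} D T = tabulate λ v →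
  sumFin {n} λ r → sumFin {m} λ c → if cell D r c ∧ does (T r c ≟F v) then 1 else 0

linComb : ∀ {n} → List ℚ → List (Poly n) → Poly n
linComb cs ps = List.concat (List.zipWith pscale cs ps)

IsZeroPoly : ∀ {n} → Poly n → Set
IsZeroPoly {n} p = (x : Mono n) → coeff p x ≡ 0ℚ

LinIndep : ∀ {n} → List (Poly n) → Set
LinIndep ps = (cs : List ℚ) → length cs ≡ length ps →
  IsZeroPoly (linComb cs ps) → All (_≡ 0ℚ) cs

-- The α-weight space of S♭_D (= image of S_D in ℂ[z]/I) is spanned by
-- the images of Δ_T with content T = α; it has dimension k.
WeightDim : ∀ {n m} → Grid n m → Vec ℕ n → ℕ → Set
WeightDim {n} {m} D α k =
  (Σ (List (Filling n m)) λ Ts → length Ts ≡ k × All (λ T → content D T ≡ α) Ts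
      × LinIndep (map (ΔI D) Ts)) ×
  ((Ts : List (Filling n m)) → length Ts ≡ suc k → All (λ T → content D T ≡ α) Ts
      → ¬ LinIndep (map (ΔI D) Ts))

CharEqKohnert : ∀ {n m} → Grid n m → Set
CharEqKohnert {n} D = (α : Vec ℕ n) → ∃[ k ] (WeightDim D α k × KohnertCoeff D α k)

-- Choose rows i < j and columns k < l with (j,k), (i,l) ∈ D and (i,k) ∉ D such that every row
-- strictly between i and j has cells only in columns occupied in row i (an uncovered cell
-- between them gives such a choice with j - i smaller); %-avoidance then puts (j,l) in D.
-- Let raise D i j be the filling sending the cells of row j that lie in columns empty in row i
-- to i, and every other cell to its own row, and let α be its content.
--
-- At the point z_{a,b} = [a = b or (a,b) = (i,j)] every column determinant of Δ_{raise D i j}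
-- is unitriangular, so it evaluates to 1: Δ_{raise D i j} is nonzero modulo I and the α-weight
-- space of S♭_D is nonzero.
--
-- No Kohnert diagram has weight α.  A Kohnert move never decreases the number of cells above a
-- given row, and α has as many cells as D above row i and above row j + 1, so along a path from
-- D to a diagram of weight α no cell crosses either boundary.  Such moves never move a cell of
-- row i, never bring a cell into row j, keep (j,k) while (j,l) is present, and leave at most one
-- cell of rows i..j in a column empty in row i.  Scoring 2 for a cell in row i and 1 for a cell
-- in row j, every column then scores at most what α demands, and column k or column l scores less.
module Submission where

open import Defs
open import Data.Nat using (ℕ)
open import Relation.Nullary using (¬_)

open import Algebra.Bundles using (CommutativeMonoid; CommutativeRing)
open import Data.Bool as Bool using (Bool; true; false; if_then_else_; _∧_; _∨_)
open import Data.Bool.Properties using (if-eta; if-cong-then; ¬-not; ∨-zeroʳ; T-≡)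
open import Data.Empty using (⊥; ⊥-elim)
open import Data.Fin as Fin using (Fin; toℕ; punchIn; punchOut)
open import Data.Fin.Properties using (punchInᵢ≢i; punchIn-punchOut; punchIn-injective; any?)
  renaming (≤∧≢⇒< to ≤∧≢⇒<ᶠ)
open import Data.List using (List; []; _∷_; _++_; map; length; allFin; tabulate; deduplicate)
open import Data.List.Membership.Propositional using (_∈_)
open import Data.List.Membership.Propositional.Properties using (∈-map⁺; ∈-deduplicate⁺)
open import Data.List.Properties using (map-tabulate)
open import Data.List.Relation.Unary.All as All using (All; []; _∷_)
import Data.List.Relation.Unary.All.Properties as All
open import Data.List.Relation.Unary.AllPairs using (AllPairs; []; _∷_)
import Data.List.Relation.Unary.AllPairs.Properties as AllPairs
open import Data.List.Relation.Unary.Any using (here; there)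
open import Data.List.Relation.Unary.Unique.Propositional using (Unique)
open import Data.List.Relation.Unary.Unique.DecPropositional.Properties using (deduplicate-!)
import Data.Nat as ℕ
open import Data.Nat using (zero; suc; _+_; _*_; _∸_; _≤_; _<_; _<?_; z≤n; z<s; s≤s; s≤s⁻¹)
open import Data.Nat.Induction using (<-wellFounded)
open import Data.Nat.ListAction using () renaming (sum to sumList)
open import Data.Nat.Properties
open import Data.Product using (Σ; Σ-syntax; ∃-syntax; _×_; _,_; proj₁; proj₂; uncurry)
open import Data.Product.Properties using (≡-dec)
open import Data.Rational as ℚ using (ℚ; 0ℚ; 1ℚ)
import Data.Rational.Properties as ℚ
open import Data.Sum as Sum using (_⊎_; inj₁; inj₂)
open import Data.Vec as Vec using (Vec; lookup)
import Data.Vec.Properties as Vec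
open import Data.Vec.Properties
  using (lookup-zipWith; lookup∘tabulate; lookup∘updateAt; lookup∘updateAt′; lookup∘update; lookup∘update′)
open import Data.Vec.Functional using (Vector; removeAt; replicate)
open import Function using (_∘_; id)
open import Function.Bundles using (Equivalence)
open import Induction.WellFounded using (Acc; acc)
open import Relation.Binary.Construct.Closure.ReflexiveTransitive using (Star; ε; _◅_)
open import Relation.Binary.Definitions using (DecidableEquality)
open import Relation.Binary.PropositionalEquality
  using (_≡_; _≢_; refl; sym; trans; cong; cong₂; subst; module ≡-Reasoning)
open import Relation.Nullary using (Dec; yes; no; does; contradiction)
import Relation.Nullary.Decidable as Dec
open import Relation.Nullary.Decidable using (T?; dec-true; dec-false; _×-dec_)

open import Algebra.Properties.CommutativeSemigroup +-commutativeSemigroup using (xy∙z≈xz∙y; x∙yz≈xz∙y)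
open import Algebra.Properties.Semiring.Sum +-*-semiring
  using (sum; sum-syntax; sum-cong-≗; sum-replicate-zero; ∑-comm; *-distribˡ-sum)
open import Algebra.Properties.CommutativeMonoid.Sum ℚ.*-1-commutativeMonoid using ()
  renaming (sum to ∏; sum-cong-≗ to ∏-cong; ∑-distrib-+ to ∏-distrib-*; sum-replicate-zero to ∏-one)
open import Algebra.Properties.Semiring.Exp (CommutativeRing.semiring ℚ.+-*-commutativeRing)
  using (_^_; ^-homo-*)
open import Algebra.Properties.CommutativeSemigroup
  (CommutativeMonoid.commutativeSemigroup ℚ.*-1-commutativeMonoid) using (interchange)
open import Algebra.Properties.CommutativeSemigroup
  (CommutativeMonoid.commutativeSemigroup ℚ.+-0-commutativeMonoid) using (x∙yz≈y∙xz)

module SumSupport {c ℓ} (M : CommutativeMonoid c ℓ) where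
  open CommutativeMonoid M
    using (Carrier; _≈_; _∙_; ∙-congˡ; ∙-congʳ; identityʳ; setoid; commutativeSemigroup)
    renaming (ε to 0#)
  open import Algebra.Properties.CommutativeSemigroup commutativeSemigroup using (xy∙z≈zy∙x)
  open import Algebra.Properties.CommutativeMonoid.Sum M as MonoidSum using () renaming (sum to ∑)
  open import Relation.Binary.Reasoning.Setoid setoid

  sum-single : ∀ {n} (t : Fin n) (f : Vector Carrier n) → (∀ x → x ≢ t → f x ≈ 0#) → ∑ f ≈ f t
  sum-single {suc n} t f off = begin
    ∑ f                       ≈⟨ MonoidSum.sum-remove f ⟩
    f t ∙ ∑ (removeAt f t)    ≈⟨ ∙-congˡ (MonoidSum.sum-cong-≋ off′) ⟩
    f t ∙ ∑ (replicate n 0#)  ≈⟨ ∙-congˡ (MonoidSum.sum-replicate-zero n) ⟩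
    f t ∙ 0#                  ≈⟨ identityʳ (f t) ⟩
    f t                       ∎
    where
    off′ : ∀ x → removeAt f t x ≈ 0#
    off′ x = off (punchIn t x) (punchInᵢ≢i t x)

  sum-pair : ∀ {n} (s t : Fin n) (f : Vector Carrier n) → s ≢ t →
             (∀ x → x ≢ s → x ≢ t → f x ≈ 0#) → ∑ f ≈ f s ∙ f t
  sum-pair {suc n} s t f s≢t off = begin
    ∑ f                       ≈⟨ MonoidSum.sum-remove f ⟩
    f s ∙ ∑ (removeAt f s)    ≈⟨ ∙-congˡ (sum-single t′ (removeAt f s) off′) ⟩
    f s ∙ f (punchIn s t′)    ≡⟨ cong (λ x → f s ∙ f x) (punchIn-punchOut s≢t) ⟩
    f s ∙ f t                 ∎
    where
    t′ : Fin n
    t′ = punchOut s≢t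
    off′ : ∀ x → x ≢ t′ → removeAt f s x ≈ 0#
    off′ x x≢t′ = off (punchIn s x) (punchInᵢ≢i s x)
      λ eq → x≢t′ (punchIn-injective s x t′ (trans eq (sym (punchIn-punchOut s≢t))))

  sum-update : ∀ {n} (t : Fin n) {f g : Vector Carrier n} → (∀ x → x ≢ t → f x ≈ g x) →
               ∑ f ∙ g t ≈ ∑ g ∙ f t
  sum-update {suc n} t {f} {g} f≈g = begin
    ∑ f ∙ g t                     ≈⟨ ∙-congʳ (MonoidSum.sum-remove f) ⟩
    f t ∙ ∑ (removeAt f t) ∙ g t  ≈⟨ ∙-congʳ (∙-congˡ (MonoidSum.sum-cong-≋ f≈g′)) ⟩
    f t ∙ ∑ (removeAt g t) ∙ g t  ≈⟨ xy∙z≈zy∙x (f t) _ (g t) ⟩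
    g t ∙ ∑ (removeAt g t) ∙ f t  ≈⟨ ∙-congʳ (MonoidSum.sum-remove g) ⟨
    ∑ g ∙ f t                     ∎
    where
    f≈g′ : ∀ x → removeAt f t x ≈ removeAt g t x
    f≈g′ x = f≈g (punchIn t x) (punchInᵢ≢i t x)

open SumSupport +-0-commutativeMonoid using ()
  renaming (sum-single to ∑-single; sum-pair to ∑-pair; sum-update to ∑-update)
open SumSupport ℚ.*-1-commutativeMonoid using () renaming (sum-single to ∏-single)

sumFin≡∑ : ∀ {k} (f : Fin k → ℕ) → sumFin f ≡ ∑[ x < k ] f x
sumFin≡∑ {zero} f = refl
sumFin≡∑ {suc k} f = cong (f Fin.zero +_) (begin
  sumList (map f (tabulate Fin.suc))   ≡⟨ cong sumList (map-tabulate Fin.suc f) ⟩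
  sumList (tabulate (f ∘ Fin.suc))     ≡⟨ cong sumList (map-tabulate id (f ∘ Fin.suc)) ⟨
  sumFin (f ∘ Fin.suc)                 ≡⟨ sumFin≡∑ (f ∘ Fin.suc) ⟩
  ∑[ x < k ] f (Fin.suc x)             ∎)
  where open ≡-Reasoning

∑-mono-≤ : ∀ {k} {f g : Fin k → ℕ} → (∀ x → f x ≤ g x) → sum f ≤ sum g
∑-mono-≤ {zero} f≤g = ≤-refl
∑-mono-≤ {suc k} f≤g = +-mono-≤ (f≤g Fin.zero) (∑-mono-≤ (f≤g ∘ Fin.suc))

∑-mono-< : ∀ {k} {f g : Fin k → ℕ} → (∀ x → f x ≤ g x) → (t : Fin k) → f t < g t → sum f < sum g
∑-mono-< f≤g Fin.zero ft<gt = +-mono-<-≤ ft<gt (∑-mono-≤ (f≤g ∘ Fin.suc))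
∑-mono-< f≤g (Fin.suc t) ft<gt = +-mono-≤-< (f≤g Fin.zero) (∑-mono-< (f≤g ∘ Fin.suc) t ft<gt)

*-b2n : ∀ x b → x * b2n b ≡ (if b then x else 0)
*-b2n x false = *-zeroʳ x
*-b2n x true = *-identityʳ x

-- Weighted cell counts

module _ {n : ℕ} where

  dot : (Fin n → ℕ) → Vec ℕ n → ℕ
  dot g α = ∑[ r < n ] (g r * lookup α r)

  ∑-indicator : (g : Fin n → ℕ) (b : Bool) (t : Fin n) →
                ∑[ v < n ] (g v * (if b ∧ does (t Fin.≟ v) then 1 else 0)) ≡ (if b then g t else 0)
  ∑-indicator g false t = trans (sum-cong-≗ λ v → *-zeroʳ (g v)) (sum-replicate-zero n)
  ∑-indicator g true t = begin
    ∑[ v < n ] (g v * (if does (t Fin.≟ v) then 1 else 0))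
      ≡⟨ ∑-single t _ off ⟩
    g t * (if does (t Fin.≟ t) then 1 else 0)
      ≡⟨ cong (λ d → g t * (if d then 1 else 0)) (dec-true (t Fin.≟ t) refl) ⟩
    g t * 1
      ≡⟨ *-identityʳ (g t) ⟩
    g t ∎
    where
    open ≡-Reasoning
    off : ∀ v → v ≢ t → g v * (if does (t Fin.≟ v) then 1 else 0) ≡ 0
    off v v≢t rewrite dec-false (t Fin.≟ v) (v≢t ∘ sym) = *-zeroʳ (g v)

module _ {n m : ℕ} where

  cell-setCell : (S : Grid n m) (r : Fin n) (c : Fin m) (b : Bool) → cell (setCell S r c b) r c ≡ b
  cell-setCell S r c b =
    trans (cong (λ row → lookup row c) (lookup∘updateAt r S)) (lookup∘update c (lookup S r) b)

  cell-setCell-other : (S : Grid n m) (r : Fin n) (c : Fin m) (b : Bool) {x : Fin n} {y : Fin m} →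
                       (x , y) ≢ (r , c) → cell (setCell S r c b) x y ≡ cell S x y
  cell-setCell-other S r c b {x} {y} xy≢rc with x Fin.≟ r
  ... | no x≢r = cong (λ row → lookup row y) (lookup∘updateAt′ x r x≢r S)
  ... | yes refl = trans (cong (λ row → lookup row y) (lookup∘updateAt r S))
                         (lookup∘update′ (λ y≡c → xy≢rc (cong (r ,_) y≡c)) (lookup S r) b)

  fillWeight : (Fin n → ℕ) → Grid n m → Filling n m → ℕ
  fillWeight g S F = ∑[ r < n ] ∑[ c < m ] (if cell S r c then g (F r c) else 0)

  rowWeight : (Fin n → ℕ) → Grid n m → ℕ
  rowWeight g S = fillWeight g S (λ r _ → r)

  dot-wt : (g : Fin n → ℕ) (S : Grid n m) → dot g (wt S) ≡ rowWeight g S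
  dot-wt g S = sum-cong-≗ λ r → begin
    g r * lookup (wt S) r                       ≡⟨ cong (g r *_) (lookup∘tabulate _ r) ⟩
    g r * sumFin (λ c → b2n (cell S r c))       ≡⟨ cong (g r *_) (sumFin≡∑ λ c → b2n (cell S r c)) ⟩
    g r * ∑[ c < m ] b2n (cell S r c)           ≡⟨ *-distribˡ-sum (g r) (λ c → b2n (cell S r c)) ⟩
    ∑[ c < m ] (g r * b2n (cell S r c))         ≡⟨ sum-cong-≗ (λ c → *-b2n (g r) (cell S r c)) ⟩
    ∑[ c < m ] (if cell S r c then g r else 0)  ∎
    where open ≡-Reasoning

  dot-content : (g : Fin n → ℕ) (D : Grid n m) (F : Filling n m) → dot g (content D F) ≡ fillWeight g D F
  dot-content g D F = begin
    ∑[ v < n ] (g v * lookup (content D F) v)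
      ≡⟨ sum-cong-≗ (λ v → cong (g v *_) (lookup∘tabulate _ v)) ⟩
    ∑[ v < n ] (g v * sumFin λ r → sumFin λ c → ι r c v)
      ≡⟨ sum-cong-≗ (λ v → cong (g v *_) (trans (sumFin≡∑ λ r → sumFin λ c → ι r c v)
                                                (sum-cong-≗ λ r → sumFin≡∑ λ c → ι r c v))) ⟩
    ∑[ v < n ] (g v * ∑[ r < n ] ∑[ c < m ] ι r c v)
      ≡⟨ sum-cong-≗ (λ v → trans (*-distribˡ-sum (g v) λ r → ∑[ c < m ] ι r c v)
                                 (sum-cong-≗ λ r → *-distribˡ-sum (g v) λ c → ι r c v)) ⟩
    ∑[ v < n ] ∑[ r < n ] ∑[ c < m ] (g v * ι r c v)
      ≡⟨ ∑-comm (λ v r → ∑[ c < m ] (g v * ι r c v)) ⟩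
    ∑[ r < n ] ∑[ v < n ] ∑[ c < m ] (g v * ι r c v)
      ≡⟨ sum-cong-≗ (λ r → ∑-comm λ v c → g v * ι r c v) ⟩
    ∑[ r < n ] ∑[ c < m ] ∑[ v < n ] (g v * ι r c v)
      ≡⟨ sum-cong-≗ (λ r → sum-cong-≗ λ c → ∑-indicator g (cell D r c) (F r c)) ⟩
    fillWeight g D F ∎
    where
    open ≡-Reasoning
    ι : Fin n → Fin m → Fin n → ℕ
    ι r c v = if cell D r c ∧ does (F r c Fin.≟ v) then 1 else 0

  ∑∑-update : (r : Fin n) (c : Fin m) {F G : Fin n → Fin m → ℕ} →
              (∀ x y → (x , y) ≢ (r , c) → F x y ≡ G x y) →
              ∑[ x < n ] ∑[ y < m ] F x y + G r c ≡ ∑[ x < n ] ∑[ y < m ] G x y + F r c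
  ∑∑-update r c {F} {G} F≡G = +-cancelʳ-≡ Gr _ _ (begin
    ΣF + G r c + Gr    ≡⟨ xy∙z≈xz∙y ΣF (G r c) Gr ⟩
    ΣF + Gr + G r c    ≡⟨ cong (_+ G r c) rows ⟩
    ΣG + Fr + G r c    ≡⟨ +-assoc ΣG Fr (G r c) ⟩
    ΣG + (Fr + G r c)  ≡⟨ cong (ΣG +_) row-r ⟩
    ΣG + (Gr + F r c)  ≡⟨ x∙yz≈xz∙y ΣG Gr (F r c) ⟩
    ΣG + F r c + Gr    ∎)
    where
    open ≡-Reasoning
    ΣF ΣG Fr Gr : ℕ
    ΣF = ∑[ x < n ] ∑[ y < m ] F x y
    ΣG = ∑[ x < n ] ∑[ y < m ] G x y
    Fr = ∑[ y < m ] F r y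
    Gr = ∑[ y < m ] G r y
    rows : ΣF + Gr ≡ ΣG + Fr
    rows = ∑-update r λ x x≢r → sum-cong-≗ λ y → F≡G x y λ { refl → x≢r refl }
    row-r : Fr + G r c ≡ Gr + F r c
    row-r = ∑-update c λ y y≢c → F≡G r y λ { refl → y≢c refl }

  rowWeight-setCell : (g : Fin n → ℕ) (S : Grid n m) (r : Fin n) (c : Fin m) (b : Bool) →
    rowWeight g (setCell S r c b) + (if cell S r c then g r else 0) ≡ rowWeight g S + (if b then g r else 0)
  rowWeight-setCell g S r c b = trans
    (∑∑-update r c λ x y xy≢rc → cong (λ d → if d then g x else 0) (cell-setCell-other S r c b xy≢rc))
    (cong (λ d → rowWeight g S + (if d then g r else 0)) (cell-setCell S r c b))

-- Kohnert moves

module _ {n : ℕ} where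

  above : ℕ → Fin n → ℕ
  above t x with toℕ x <? t
  ... | yes _ = 1
  ... | no _ = 0

  above-< : ∀ t {x : Fin n} → toℕ x < t → above t x ≡ 1
  above-< t {x} x<t with toℕ x <? t
  ... | yes _ = refl
  ... | no x≮t = contradiction x<t x≮t

  above-≮ : ∀ t {x : Fin n} → ¬ toℕ x < t → above t x ≡ 0
  above-≮ t {x} x≮t with toℕ x <? t
  ... | yes x<t = contradiction x<t x≮t
  ... | no _ = refl

  above-antitone : ∀ t {x y : Fin n} → toℕ y < toℕ x → above t x ≤ above t y
  above-antitone t {x} {y} y<x with toℕ x <? t
  ... | no _ = z≤n
  ... | yes x<t = ≤-reflexive (sym (above-< t (<-trans y<x x<t)))

module _ {n m : ℕ} where

  _≟ᶜ_ : DecidableEquality (Fin n × Fin m)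
  _≟ᶜ_ = ≡-dec Fin._≟_ Fin._≟_

  moveCell : Grid n m → Fin n → Fin m → Fin n → Grid n m
  moveCell S r c r′ = setCell (setCell S r c false) r′ c true

  cell-moveCell-other : (S : Grid n m) (r : Fin n) (c : Fin m) (r′ : Fin n) {x : Fin n} {y : Fin m} →
                        (x , y) ≢ (r , c) → (x , y) ≢ (r′ , c) → cell (moveCell S r c r′) x y ≡ cell S x y
  cell-moveCell-other S r c r′ xy≢rc xy≢r′c =
    trans (cell-setCell-other (setCell S r c false) r′ c true xy≢r′c) (cell-setCell-other S r c false xy≢rc)

  rowWeight-moveCell : (g : Fin n → ℕ) (S : Grid n m) {r r′ : Fin n} {c : Fin m} → r′ ≢ r →
                       cell S r c ≡ true → cell S r′ c ≡ false →
                       rowWeight g (moveCell S r c r′) + g r ≡ rowWeight g S + g r′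
  rowWeight-moveCell g S {r} {r′} {c} r′≢r rc∈S r′c∉S = begin
    W′ + g r              ≡⟨ cong (_+ g r) added ⟩
    W₁ + g r′ + g r       ≡⟨ xy∙z≈xz∙y W₁ (g r′) (g r) ⟩
    W₁ + g r + g r′       ≡⟨ cong (_+ g r′) removed ⟩
    rowWeight g S + g r′  ∎
    where
    open ≡-Reasoning
    S₁ : Grid n m
    S₁ = setCell S r c false
    W₁ W′ : ℕ
    W₁ = rowWeight g S₁
    W′ = rowWeight g (moveCell S r c r′)
    removed : W₁ + g r ≡ rowWeight g S
    removed = trans (subst (λ d → W₁ + (if d then g r else 0) ≡ rowWeight g S + 0) rc∈S
                           (rowWeight-setCell g S r c false))
                    (+-identityʳ (rowWeight g S))
    r′c∉S₁ : cell S₁ r′ c ≡ false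
    r′c∉S₁ = trans (cell-setCell-other S r c false λ { refl → r′≢r refl }) r′c∉S
    added : W′ ≡ W₁ + g r′
    added = trans (sym (+-identityʳ W′))
                  (subst (λ d → W′ + (if d then g r′ else 0) ≡ W₁ + g r′) r′c∉S₁
                         (rowWeight-setCell g S₁ r′ c true))

  source target : {S S′ : Grid n m} → KohnertMove S S′ → Fin n
  source (r , _) = r
  target (_ , _ , r′ , _) = r′

  column : {S S′ : Grid n m} → KohnertMove S S′ → Fin m
  column (_ , c , _) = c

  cell-move⁻ : {S S′ : Grid n m} (mv : KohnertMove S S′) {x : Fin n} {y : Fin m} → cell S′ x y ≡ true →
               (x , y) ≡ (target mv , column mv) ⊎ (cell S x y ≡ true × (x , y) ≢ (source mv , column mv))
  cell-move⁻ {S} (r , c , r′ , _ , _ , _ , _ , _ , refl) {x} {y} xy∈S′ with (x , y) ≟ᶜ (r′ , c)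
  ... | yes xy≡r′c = inj₁ xy≡r′c
  ... | no xy≢r′c with (x , y) ≟ᶜ (r , c)
  ...   | no xy≢rc = inj₂ (trans (sym (cell-moveCell-other S r c r′ xy≢rc xy≢r′c)) xy∈S′ , xy≢rc)
  ...   | yes refl = contradiction (trans (sym rc∉S′) xy∈S′) λ ()
    where
    rc∉S′ : cell (moveCell S r c r′) r c ≡ false
    rc∉S′ = trans (cell-setCell-other (setCell S r c false) r′ c true xy≢r′c) (cell-setCell S r c false)

  cell-move⁺ : {S S′ : Grid n m} (mv : KohnertMove S S′) {x : Fin n} {y : Fin m} → cell S x y ≡ true →
               (x , y) ≢ (source mv , column mv) → cell S′ x y ≡ true
  cell-move⁺ {S} (r , c , r′ , _ , _ , _ , _ , _ , refl) {x} {y} xy∈S xy≢rc with (x , y) ≟ᶜ (r′ , c)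
  ... | yes refl = cell-setCell (setCell S r c false) r′ c true
  ... | no xy≢r′c = trans (cell-moveCell-other S r c r′ xy≢rc xy≢r′c) xy∈S

  rowWeight-move : (g : Fin n → ℕ) {S S′ : Grid n m} (mv : KohnertMove S S′) →
                   rowWeight g S′ + g (source mv) ≡ rowWeight g S + g (target mv)
  rowWeight-move g {S} (r , c , r′ , rc∈S , _ , r′<r , r′c∉S , _ , refl) =
    rowWeight-moveCell g S (λ { refl → <-irrefl refl r′<r }) rc∈S r′c∉S

  topRows : ℕ → Grid n m → ℕ
  topRows t = rowWeight (above t)

  topRows-move : ∀ t {S S′ : Grid n m} → KohnertMove S S′ → topRows t S ≤ topRows t S′
  topRows-move t {S} {S′} mv@(_ , _ , _ , _ , _ , r′<r , _) = +-cancelʳ-≤ (above t (source mv)) _ _ (begin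
    topRows t S + above t (source mv)   ≤⟨ +-monoʳ-≤ (topRows t S) (above-antitone t r′<r) ⟩
    topRows t S + above t (target mv)   ≡⟨ rowWeight-move (above t) mv ⟨
    topRows t S′ + above t (source mv)  ∎)
    where open ≤-Reasoning

  topRows-path : ∀ t {S T : Grid n m} → Star KohnertMove S T → topRows t S ≤ topRows t T
  topRows-path t ε = ≤-refl
  topRows-path t (mv ◅ path) = ≤-trans (topRows-move t mv) (topRows-path t path)

  move-stays-above : ∀ t {S S′ : Grid n m} (mv : KohnertMove S S′) → topRows t S′ ≤ topRows t S →
                     toℕ (target mv) < t → toℕ (source mv) < t
  move-stays-above t {S} {S′} mv S′≤S r′<t with toℕ (source mv) <? t
  ... | yes r<t = r<t
  ... | no r≮t = contradiction S′≤S (<⇒≱ (begin-strict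
    topRows t S                         <⟨ m<m+n (topRows t S) z<s ⟩
    topRows t S + 1                     ≡⟨ cong (topRows t S +_) (above-< t r′<t) ⟨
    topRows t S + above t (target mv)   ≡⟨ rowWeight-move (above t) mv ⟨
    topRows t S′ + above t (source mv)  ≡⟨ cong (topRows t S′ +_) (above-≮ t r≮t) ⟩
    topRows t S′ + 0                    ≡⟨ +-identityʳ (topRows t S′) ⟩
    topRows t S′                        ∎))
    where open ≤-Reasoning

-- Violations of the northwest condition

module _ {n m : ℕ} (D : Grid n m) where

  record NWViolation (i j : Fin n) (k l : Fin m) : Set where
    constructor nwViolation
    field
      i<j : i Fin.< j
      k<l : k Fin.< l
      jk∈D : cell D j k ≡ true
      il∈D : cell D i l ≡ true
      ik∉D : cell D i k ≡ false

  Violation : Set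
  Violation = ∃[ i ] ∃[ j ] ∃[ k ] ∃[ l ] NWViolation i j k l

  RowsBetweenCovered : Fin n → Fin n → Set
  RowsBetweenCovered i j =
    (r : Fin n) (c : Fin m) → i Fin.< r → r Fin.< j → cell D r c ≡ true → cell D i c ≡ true

  nwViolation? : ∀ i j k l → Dec (NWViolation i j k l)
  nwViolation? i j k l =
    Dec.map′ (λ (i<j , k<l , jk∈D , il∈D , ik∉D) → nwViolation i<j k<l jk∈D il∈D ik∉D)
             (λ (nwViolation i<j k<l jk∈D il∈D ik∉D) → i<j , k<l , jk∈D , il∈D , ik∉D)
             (i Fin.<? j ×-dec k Fin.<? l ×-dec
              cell D j k Bool.≟ true ×-dec cell D i l Bool.≟ true ×-dec cell D i k Bool.≟ false)

  violation-of-¬northwest : ¬ Northwest D → Violation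
  violation-of-¬northwest ¬northwest with any? (λ i → any? λ j → any? λ k → any? λ l → nwViolation? i j k l)
  ... | yes violation = violation
  ... | no none = contradiction northwest ¬northwest
    where
    northwest : Northwest D
    northwest i j k l i<j k<l jk∈D il∈D =
      ¬-not λ ik∉D → none (i , j , k , l , nwViolation i<j k<l jk∈D il∈D ik∉D)

  gap : Violation → ℕ
  gap (i , j , _) = toℕ j ∸ toℕ i

  uncovered? : (i j : Fin n) →
               Dec (Σ[ r ∈ Fin n ] Σ[ c ∈ Fin m ] (i Fin.< r × r Fin.< j × cell D r c ≡ true × cell D i c ≡ false))
  uncovered? i j = any? λ r → any? λ c →
    i Fin.<? r ×-dec r Fin.<? j ×-dec cell D r c Bool.≟ true ×-dec cell D i c Bool.≟ false

  narrow : ∀ {i j r : Fin n} {k l c : Fin m} → NWViolation i j k l →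
           i Fin.< r → r Fin.< j → cell D r c ≡ true → cell D i c ≡ false →
           ∃[ k′ ] ∃[ l′ ] NWViolation i r k′ l′ ⊎ ∃[ k′ ] ∃[ l′ ] NWViolation r j k′ l′
  narrow {r = r} {k} {l} {c} (nwViolation _ k<l jk∈D il∈D ik∉D) i<r r<j rc∈D ic∉D
    with cell D r k in rk | k Fin.<? c
  ... | true | _ = inj₁ (k , l , nwViolation i<r k<l rk il∈D ik∉D)
  ... | false | yes k<c = inj₂ (k , c , nwViolation r<j k<c jk∈D rc∈D rk)
  ... | false | no k≮c = inj₁ (c , l , nwViolation i<r (≤-<-trans (≮⇒≥ k≮c) k<l) rc∈D il∈D ic∉D)

  covered-violation : (v : Violation) → Acc _<_ (gap v) →
                      ∃[ i ] ∃[ j ] ∃[ k ] ∃[ l ] (NWViolation i j k l × RowsBetweenCovered i j)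
  covered-violation (i , j , k , l , violation) (acc smaller) with uncovered? i j
  ... | no none = i , j , k , l , violation , covered
    where
    covered : RowsBetweenCovered i j
    covered r c i<r r<j rc∈D = ¬-not λ ic∉D → none (r , c , i<r , r<j , rc∈D , ic∉D)
  ... | yes (r , c , i<r , r<j , rc∈D , ic∉D) with narrow violation i<r r<j rc∈D ic∉D
  ...   | inj₁ (k′ , l′ , upper) =
    covered-violation (i , r , k′ , l′ , upper) (smaller (∸-monoˡ-< r<j (<⇒≤ i<r)))
  ...   | inj₂ (k′ , l′ , lower) =
    covered-violation (r , j , k′ , l′ , lower) (smaller (∸-monoʳ-< i<r (<⇒≤ r<j)))

  %-avoiding⇒jl∈D : PercentAvoiding D → ∀ {i j k l} → NWViolation i j k l → cell D j l ≡ true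
  %-avoiding⇒jl∈D %-avoiding (nwViolation i<j k<l jk∈D il∈D ik∉D) with %-avoiding _ _ _ _ i<j k<l jk∈D il∈D
  ... | inj₁ ik∈D = contradiction (trans (sym ik∈D) ik∉D) λ ()
  ... | inj₂ jl∈D = jl∈D

-- The raised filling has no Kohnert diagram of its weight

module _ {n m : ℕ} (D : Grid n m) where

  raise : Fin n → Fin n → Filling n m
  raise i j r c with r Fin.≟ j | cell D i c
  ... | yes _ | false = i
  ... | yes _ | true = r
  ... | no _ | _ = r

  raise-other : ∀ {i j x} c → x ≢ j → raise i j x c ≡ x
  raise-other {j = j} {x} c x≢j with x Fin.≟ j
  ... | yes x≡j = contradiction x≡j x≢j
  ... | no _ = refl

  fillWeight-raise : (g : Fin n → ℕ) {i j : Fin n} → g i ≡ g j → fillWeight g D (raise i j) ≡ rowWeight g D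
  fillWeight-raise g {i} {j} gi≡gj =
    sum-cong-≗ λ r → sum-cong-≗ λ c → cong (λ x → if cell D r c then x else 0) (g-raise r c)
    where
    g-raise : ∀ r c → g (raise i j r c) ≡ g r
    g-raise r c with r Fin.≟ j | cell D i c
    ... | yes refl | false = gi≡gj
    ... | yes _ | true = refl
    ... | no _ | _ = refl

  rowWeight-preserved : (g : Fin n → ℕ) {i j : Fin n} {T : Grid n m} → wt T ≡ content D (raise i j) →
                        g i ≡ g j → rowWeight g T ≡ rowWeight g D
  rowWeight-preserved g {i} {j} {T} wtT≡α gi≡gj = begin
    rowWeight g T                  ≡⟨ dot-wt g T ⟨
    dot g (wt T)                   ≡⟨ cong (dot g) wtT≡α ⟩
    dot g (content D (raise i j))  ≡⟨ dot-content g D (raise i j) ⟩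
    fillWeight g D (raise i j)     ≡⟨ fillWeight-raise g {i} {j} gi≡gj ⟩
    rowWeight g D                  ∎
    where open ≡-Reasoning

columnScore : Bool → Bool → ℕ
columnScore x y = (if x then 2 else 0) + (if y then 1 else 0)

columnScore-≤ : ∀ a b x y → (a ≡ true → x ≡ true) → (y ≡ true → b ≡ true) →
                (a ≡ false → x ≡ true → b ≡ true) → (a ≡ false → x ≡ true → y ≡ true → ⊥) →
                columnScore x y ≤ columnScore (a ∨ b) (a ∧ b)
columnScore-≤ true  _     false _     a⇒x _   _    _      = contradiction (a⇒x refl) λ ()
columnScore-≤ true  true  true  true  _   _   _    _      = ≤-refl
columnScore-≤ true  true  true  false _   _   _    _      = n≤1+n 2
columnScore-≤ true  false true  false _   _   _    _      = ≤-refl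
columnScore-≤ true  false true  true  _   y⇒b _    _      = contradiction (y⇒b refl) λ ()
columnScore-≤ false _     true  true  _   _   _    ¬a⇒¬xy = ⊥-elim (¬a⇒¬xy refl refl refl)
columnScore-≤ false true  true  false _   _   _    _      = ≤-refl
columnScore-≤ false false true  false _   _   ¬a⇒b _      = contradiction (¬a⇒b refl refl) λ ()
columnScore-≤ false true  false true  _   _   _    _      = n≤1+n 1
columnScore-≤ false true  false false _   _   _    _      = z≤n
columnScore-≤ false false false false _   _   _    _      = ≤-refl
columnScore-≤ false false false true  _   y⇒b _    _      = contradiction (y⇒b refl) λ ()

columnScore-<-raised-missing : ∀ {a b x y} → a ≡ false → b ≡ true → x ≡ false →
                               columnScore x y < columnScore (a ∨ b) (a ∧ b)
columnScore-<-raised-missing {y = true} refl refl refl = n<1+n 1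
columnScore-<-raised-missing {y = false} refl refl refl = z<s

columnScore-<-kept-missing : ∀ {a b x y} → a ≡ true → b ≡ true → y ≡ false →
                             columnScore x y < columnScore (a ∨ b) (a ∧ b)
columnScore-<-kept-missing {x = true} refl refl refl = n<1+n 2
columnScore-<-kept-missing {x = false} refl refl refl = z<s

module NoKohnertDiagram {n m : ℕ} (D : Grid n m) {i j : Fin n} {k l : Fin m}
  (violation : NWViolation D i j k l) (jl∈D : cell D j l ≡ true) (covered : RowsBetweenCovered D i j) where

  open NWViolation violation

  Band : Fin n → Set
  Band x = i Fin.≤ x × x Fin.≤ j

  band-i : Band i
  band-i = ≤-refl , <⇒≤ i<j

  band-j : Band j
  band-j = <⇒≤ i<j , ≤-refl

  i≢j : i ≢ j
  i≢j refl = <-irrefl refl i<j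

  record Invariant (S : Grid n m) : Set where
    field
      row-i-kept : ∀ c → cell D i c ≡ true → cell S i c ≡ true
      row-j-old : ∀ c → cell S j c ≡ true → cell D j c ≡ true
      jl⇒jk : cell S j l ≡ true → cell S j k ≡ true
      band-cell⇒jc∈D : ∀ c → cell D i c ≡ false → ∀ x → Band x → cell S x c ≡ true → cell D j c ≡ true
      band-cell-unique : ∀ c → cell D i c ≡ false → ∀ x y → Band x → Band y →
                         cell S x c ≡ true → cell S y c ≡ true → x ≡ y

  band-cell-of-D : ∀ {x c} → Band x → cell D x c ≡ true → cell D i c ≡ false → x ≡ j
  band-cell-of-D {x} {c} (i≤x , x≤j) xc∈D ic∉D with x Fin.≟ j
  ... | yes x≡j = x≡j
  ... | no x≢j = contradiction (trans (sym ic∈D) ic∉D) λ ()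
    where
    i≢x : i ≢ x
    i≢x refl = contradiction (trans (sym xc∈D) ic∉D) λ ()
    ic∈D : cell D i c ≡ true
    ic∈D = covered x c (≤∧≢⇒<ᶠ i≤x i≢x) (≤∧≢⇒<ᶠ x≤j x≢j) xc∈D

  invariant-D : Invariant D
  invariant-D = record
    { row-i-kept = λ _ ic∈D → ic∈D
    ; row-j-old = λ _ jc∈D → jc∈D
    ; jl⇒jk = λ _ → jk∈D
    ; band-cell⇒jc∈D = λ c ic∉D x bx xc∈D →
        subst (λ z → cell D z c ≡ true) (band-cell-of-D bx xc∈D ic∉D) xc∈D
    ; band-cell-unique = λ c ic∉D x y bx by xc∈D yc∈D →
        trans (band-cell-of-D bx xc∈D ic∉D) (sym (band-cell-of-D by yc∈D ic∉D))
    }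

  invariant-move : {S S′ : Grid n m} (mv : KohnertMove S S′) →
                   (toℕ (target mv) < toℕ i → toℕ (source mv) < toℕ i) →
                   (toℕ (target mv) < suc (toℕ j) → toℕ (source mv) < suc (toℕ j)) →
                   Invariant S → Invariant S′
  invariant-move {S} {S′} mv@(r , c , r′ , rc∈S , rightmost , r′<r , _) stays-above-i stays-above-j I = record
    { row-i-kept = λ c₀ ic₀∈D → cell-move⁺ mv (row-i-kept c₀ ic₀∈D) (r≢i ∘ sym ∘ cong proj₁)
    ; row-j-old = row-j-old′
    ; jl⇒jk = jl⇒jk′
    ; band-cell⇒jc∈D = band-cell⇒jc∈D′
    ; band-cell-unique = band-cell-unique′
    }
    where
    open Invariant I

    r≢i : r ≢ i
    r≢i refl = <-irrefl refl (stays-above-i r′<r)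

    r′≢j : r′ ≢ j
    r′≢j refl = <⇒≱ r′<r (s≤s⁻¹ (stays-above-j ≤-refl))

    band-source : Band r′ → Band r
    band-source (i≤r′ , r′≤j) = ≤-trans i≤r′ (<⇒≤ r′<r) , s≤s⁻¹ (stays-above-j (s≤s r′≤j))

    row-j-old′ : ∀ c₀ → cell S′ j c₀ ≡ true → cell D j c₀ ≡ true
    row-j-old′ c₀ jc₀∈S′ with cell-move⁻ mv jc₀∈S′
    ... | inj₁ jc₀≡r′c = contradiction (sym (cong proj₁ jc₀≡r′c)) r′≢j
    ... | inj₂ (jc₀∈S , _) = row-j-old c₀ jc₀∈S

    jl⇒jk′ : cell S′ j l ≡ true → cell S′ j k ≡ true
    jl⇒jk′ jl∈S′ with cell-move⁻ mv jl∈S′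
    ... | inj₁ jl≡r′c = contradiction (sym (cong proj₁ jl≡r′c)) r′≢j
    ... | inj₂ (jl∈S , _) = cell-move⁺ mv (jl⇒jk jl∈S) jk≢rc
      where
      jk≢rc : (j , k) ≢ (r , c)
      jk≢rc refl = contradiction (trans (sym jl∈S) (rightmost l k<l)) λ ()

    band-cell⇒jc∈D′ : ∀ c₀ → cell D i c₀ ≡ false → ∀ x → Band x → cell S′ x c₀ ≡ true →
                      cell D j c₀ ≡ true
    band-cell⇒jc∈D′ c₀ ic₀∉D x bx xc₀∈S′ with cell-move⁻ mv xc₀∈S′
    ... | inj₁ refl = band-cell⇒jc∈D c ic₀∉D r (band-source bx) rc∈S
    ... | inj₂ (xc₀∈S , _) = band-cell⇒jc∈D c₀ ic₀∉D x bx xc₀∈S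

    band-cell-unique′ : ∀ c₀ → cell D i c₀ ≡ false → ∀ x y → Band x → Band y →
                        cell S′ x c₀ ≡ true → cell S′ y c₀ ≡ true → x ≡ y
    band-cell-unique′ c₀ ic₀∉D x y bx by xc₀∈S′ yc₀∈S′
      with cell-move⁻ mv xc₀∈S′ | cell-move⁻ mv yc₀∈S′
    ... | inj₁ refl | inj₁ refl = refl
    ... | inj₁ refl | inj₂ (yc∈S , yc≢rc) =
      contradiction (cong (_, c) (sym (band-cell-unique c ic₀∉D r y (band-source bx) by rc∈S yc∈S))) yc≢rc
    ... | inj₂ (xc∈S , xc≢rc) | inj₁ refl =
      contradiction (cong (_, c) (band-cell-unique c ic₀∉D x r bx (band-source by) xc∈S rc∈S)) xc≢rc
    ... | inj₂ (xc₀∈S , _) | inj₂ (yc₀∈S , _) = band-cell-unique c₀ ic₀∉D x y bx by xc₀∈S yc₀∈S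

  invariant-path : ∀ {S T} → Star KohnertMove S T →
                   topRows (toℕ i) T ≤ topRows (toℕ i) S →
                   topRows (suc (toℕ j)) T ≤ topRows (suc (toℕ j)) S →
                   Invariant S → Invariant T
  invariant-path ε _ _ I = I
  invariant-path (mv ◅ path) Ti≤Si Tj≤Sj I =
    invariant-path path (≤-trans Ti≤Si (topRows-move _ mv)) (≤-trans Tj≤Sj (topRows-move _ mv))
      (invariant-move mv (move-stays-above _ mv (≤-trans (topRows-path _ path) Ti≤Si))
                         (move-stays-above _ mv (≤-trans (topRows-path _ path) Tj≤Sj)) I)

  score : Fin n → ℕ
  score x with x Fin.≟ i | x Fin.≟ j
  ... | yes _ | _ = 2
  ... | no _ | yes _ = 1
  ... | no _ | no _ = 0

  score-i : score i ≡ 2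
  score-i with i Fin.≟ i
  ... | yes _ = refl
  ... | no i≢i = contradiction refl i≢i

  score-j : score j ≡ 1
  score-j with j Fin.≟ i | j Fin.≟ j
  ... | yes j≡i | _ = contradiction (sym j≡i) i≢j
  ... | no _ | yes _ = refl
  ... | no _ | no j≢j = contradiction refl j≢j

  score-other : ∀ {x} → x ≢ i → x ≢ j → score x ≡ 0
  score-other {x} x≢i x≢j with x Fin.≟ i | x Fin.≟ j
  ... | yes x≡i | _ = contradiction x≡i x≢i
  ... | no _ | yes x≡j = contradiction x≡j x≢j
  ... | no _ | no _ = refl

  score-raise-j : ∀ c → score (raise D i j j c) ≡ (if cell D i c then 1 else 2)
  score-raise-j c with j Fin.≟ j | cell D i c
  ... | yes _ | true = score-j
  ... | yes _ | false = score-i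
  ... | no j≢j | _ = contradiction refl j≢j

  columnScoreOf : Grid n m → Fin m → ℕ
  columnScoreOf T c = columnScore (cell T i c) (cell T j c)

  raisedScore : Fin m → ℕ
  raisedScore c = columnScore (cell D i c ∨ cell D j c) (cell D i c ∧ cell D j c)

  rowWeight-score : (T : Grid n m) → rowWeight score T ≡ ∑[ c < m ] columnScoreOf T c
  rowWeight-score T = trans (∑-comm λ r c → if cell T r c then score r else 0) (sum-cong-≗ λ c →
    trans (∑-pair i j (λ r → if cell T r c then score r else 0) i≢j (off c))
          (cong₂ _+_ (if-cong-then (cell T i c) score-i) (if-cong-then (cell T j c) score-j)))
    where
    off : ∀ c x → x ≢ i → x ≢ j → (if cell T x c then score x else 0) ≡ 0
    off c x x≢i x≢j = trans (if-cong-then (cell T x c) (score-other x≢i x≢j)) (if-eta (cell T x c))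

  raised-columnScore : ∀ a b → (if a then 2 else 0) + (if b then (if a then 1 else 2) else 0) ≡
                               columnScore (a ∨ b) (a ∧ b)
  raised-columnScore true true = refl
  raised-columnScore true false = refl
  raised-columnScore false true = refl
  raised-columnScore false false = refl

  fillWeight-score : fillWeight score D (raise D i j) ≡ ∑[ c < m ] raisedScore c
  fillWeight-score = trans (∑-comm λ r c → if cell D r c then score (raise D i j r c) else 0) (sum-cong-≗ λ c →
    trans (∑-pair i j (λ r → if cell D r c then score (raise D i j r c) else 0) i≢j (off c)) (begin
      (if cell D i c then score (raise D i j i c) else 0) + (if cell D j c then score (raise D i j j c) else 0)
        ≡⟨ cong₂ _+_ (if-cong-then (cell D i c) (trans (cong score (raise-other D c i≢j)) score-i))
                     (if-cong-then (cell D j c) (score-raise-j c)) ⟩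
      (if cell D i c then 2 else 0) + (if cell D j c then (if cell D i c then 1 else 2) else 0)
        ≡⟨ raised-columnScore (cell D i c) (cell D j c) ⟩
      raisedScore c ∎))
    where
    open ≡-Reasoning
    off : ∀ c x → x ≢ i → x ≢ j → (if cell D x c then score (raise D i j x c) else 0) ≡ 0
    off c x x≢i x≢j =
      trans (if-cong-then (cell D x c) (trans (cong score (raise-other D c x≢j)) (score-other x≢i x≢j)))
            (if-eta (cell D x c))

  module _ {T : Grid n m} (I : Invariant T) where
    open Invariant I

    column-bound : ∀ c → columnScoreOf T c ≤ raisedScore c
    column-bound c = columnScore-≤ (cell D i c) (cell D j c) (cell T i c) (cell T j c) (row-i-kept c) (row-j-old c)
      (λ ic∉D ic∈T → band-cell⇒jc∈D c ic∉D i band-i ic∈T)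
      (λ ic∉D ic∈T jc∈T → i≢j (band-cell-unique c ic∉D i j band-i band-j ic∈T jc∈T))

    strict-column : Σ[ c ∈ Fin m ] columnScoreOf T c < raisedScore c
    strict-column with cell T j k in jk∈T
    ... | true = k , columnScore-<-raised-missing ik∉D jk∈D
                       (¬-not λ ik∈T → i≢j (band-cell-unique k ik∉D i j band-i band-j ik∈T jk∈T))
    ... | false = l , columnScore-<-kept-missing il∈D jl∈D
                        (¬-not λ jl∈T → contradiction (trans (sym (jl⇒jk jl∈T)) jk∈T) λ ())

  no-kohnert-diagram : ∀ {T} → KD D T → wt T ≢ content D (raise D i j)
  no-kohnert-diagram {T} path wtT≡α =
    <-irrefl scores-equal (∑-mono-< (column-bound I) (proj₁ (strict-column I)) (proj₂ (strict-column I)))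
    where
    I : Invariant T
    I = invariant-path path
          (≤-reflexive (rowWeight-preserved D (above (toℕ i)) {T = T} wtT≡α
            (trans (above-≮ _ (<-irrefl refl)) (sym (above-≮ _ (<⇒≯ i<j))))))
          (≤-reflexive (rowWeight-preserved D (above (suc (toℕ j))) {T = T} wtT≡α
            (trans (above-< _ (s≤s (<⇒≤ i<j))) (sym (above-< _ ≤-refl)))))
          invariant-D
    scores-equal : ∑[ c < m ] columnScoreOf T c ≡ ∑[ c < m ] raisedScore c
    scores-equal = begin
      ∑[ c < m ] columnScoreOf T c         ≡⟨ rowWeight-score T ⟨
      rowWeight score T                    ≡⟨ dot-wt score T ⟨
      dot score (wt T)                     ≡⟨ cong (dot score) wtT≡α ⟩
      dot score (content D (raise D i j))  ≡⟨ dot-content score D (raise D i j) ⟩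
      fillWeight score D (raise D i j)     ≡⟨ fillWeight-score ⟩
      ∑[ c < m ] raisedScore c             ∎
      where open ≡-Reasoning

-- Evaluating polynomials at a point

IsSplit : ∀ {B : Set} → List B → B × List B → Set
IsSplit bs (x , r) = suc (length r) ≡ length bs × (∀ {z} → z ∈ bs → z ≡ x ⊎ z ∈ r)

minors-split : ∀ {B : Set} (bs : List B) → All (IsSplit bs) (minors bs)
minors-split [] = []
minors-split (b ∷ bs) = (refl , split-head) ∷ All.map⁺ (All.map extend (minors-split bs))
  where
  split-head : ∀ {z} → z ∈ b ∷ bs → z ≡ b ⊎ z ∈ bs
  split-head (here z≡b) = inj₁ z≡b
  split-head (there z∈bs) = inj₂ z∈bs
  extend : ∀ {xr} → IsSplit bs xr → IsSplit (b ∷ bs) (proj₁ xr , b ∷ proj₂ xr)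
  extend (len , split) = cong suc len , λ where
    (here z≡b) → inj₂ (here z≡b)
    (there z∈bs) → Sum.map₂ there (split z∈bs)

module Evaluation {n : ℕ} (v : Fin n → Fin n → ℚ) where

  evalMono : Mono n → ℚ
  evalMono x = ∏ λ a → ∏ λ b → v a b ^ lookup (lookup x a) b

  evalMono-monoMul : ∀ x y → evalMono (monoMul x y) ≡ evalMono x ℚ.* evalMono y
  evalMono-monoMul x y = begin
    ∏ (λ a → ∏ λ b → v a b ^ lookup (lookup (monoMul x y) a) b)
      ≡⟨ ∏-cong (λ a → ∏-cong λ b → cong (v a b ^_) (exponent a b)) ⟩
    ∏ (λ a → ∏ λ b → v a b ^ (e x a b ℕ.+ e y a b))
      ≡⟨ ∏-cong (λ a → ∏-cong λ b → ^-homo-* (v a b) (e x a b) (e y a b)) ⟩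
    ∏ (λ a → ∏ λ b → v a b ^ e x a b ℚ.* v a b ^ e y a b)
      ≡⟨ ∏-cong (λ a → ∏-distrib-* (λ b → v a b ^ e x a b) (λ b → v a b ^ e y a b)) ⟩
    ∏ (λ a → (∏ λ b → v a b ^ e x a b) ℚ.* (∏ λ b → v a b ^ e y a b))
      ≡⟨ ∏-distrib-* (λ a → ∏ λ b → v a b ^ e x a b) (λ a → ∏ λ b → v a b ^ e y a b) ⟩
    evalMono x ℚ.* evalMono y ∎
    where
    open ≡-Reasoning
    e : Mono n → Fin n → Fin n → ℕ
    e z a b = lookup (lookup z a) b
    exponent : ∀ a b → e (monoMul x y) a b ≡ e x a b ℕ.+ e y a b
    exponent a b = trans (cong (λ row → lookup row b) (lookup-zipWith (Vec.zipWith ℕ._+_) a x y))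
                         (lookup-zipWith ℕ._+_ b (lookup x a) (lookup y a))

  evalMono-one : evalMono monoOne ≡ 1ℚ
  evalMono-one =
    trans (∏-cong λ a → trans (∏-cong λ b → cong (v a b ^_) (zero-entry a b)) (∏-one n)) (∏-one n)
    where
    zero-entry : ∀ a b → lookup (lookup (monoOne {n}) a) b ≡ 0
    zero-entry a b = trans (cong (λ row → lookup row b) (lookup∘tabulate _ a)) (lookup∘tabulate _ b)

  unitMono : Fin n → Fin n → Mono n
  unitMono a b =
    Vec.tabulate λ a′ → Vec.tabulate λ b′ → if does (a′ Fin.≟ a) ∧ does (b′ Fin.≟ b) then 1 else 0

  evalMono-unitMono : ∀ a b → evalMono (unitMono a b) ≡ v a b
  evalMono-unitMono a b = begin
    ∏ (λ a′ → ∏ λ b′ → v a′ b′ ^ lookup (lookup (unitMono a b) a′) b′)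
      ≡⟨ ∏-cong (λ a′ → ∏-cong λ b′ → cong (v a′ b′ ^_) (exponent a′ b′)) ⟩
    ∏ (λ a′ → ∏ λ b′ → v a′ b′ ^ δ a′ b′)
      ≡⟨ ∏-single a _ other-row ⟩
    ∏ (λ b′ → v a b′ ^ δ a b′)
      ≡⟨ ∏-cong (λ b′ → cong (λ d → v a b′ ^ (if d ∧ does (b′ Fin.≟ b) then 1 else 0))
                             (dec-true (a Fin.≟ a) refl)) ⟩
    ∏ (λ b′ → v a b′ ^ (if does (b′ Fin.≟ b) then 1 else 0))
      ≡⟨ ∏-single b _ other-column ⟩
    v a b ^ (if does (b Fin.≟ b) then 1 else 0)
      ≡⟨ cong (λ d → v a b ^ (if d then 1 else 0)) (dec-true (b Fin.≟ b) refl) ⟩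
    v a b ℚ.* 1ℚ
      ≡⟨ ℚ.*-identityʳ (v a b) ⟩
    v a b ∎
    where
    open ≡-Reasoning
    δ : Fin n → Fin n → ℕ
    δ a′ b′ = if does (a′ Fin.≟ a) ∧ does (b′ Fin.≟ b) then 1 else 0
    exponent : ∀ a′ b′ → lookup (lookup (unitMono a b) a′) b′ ≡ δ a′ b′
    exponent a′ b′ = trans (cong (λ row → lookup row b′) (lookup∘tabulate _ a′)) (lookup∘tabulate _ b′)
    other-row : ∀ a′ → a′ ≢ a → ∏ (λ b′ → v a′ b′ ^ δ a′ b′) ≡ 1ℚ
    other-row a′ a′≢a =
      trans (∏-cong λ b′ → cong (λ d → v a′ b′ ^ (if d ∧ does (b′ Fin.≟ b) then 1 else 0))
                                (dec-false (a′ Fin.≟ a) a′≢a))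
            (∏-one n)
    other-column : ∀ b′ → b′ ≢ b → v a b′ ^ (if does (b′ Fin.≟ b) then 1 else 0) ≡ 1ℚ
    other-column b′ b′≢b = cong (λ d → v a b′ ^ (if d then 1 else 0)) (dec-false (b′ Fin.≟ b) b′≢b)

  term : ℚ × Mono n → ℚ
  term (c , x) = c ℚ.* evalMono x

  eval : Poly n → ℚ
  eval [] = 0ℚ
  eval (t ∷ p) = term t ℚ.+ eval p

  eval-++ : ∀ p q → eval (p ++ q) ≡ eval p ℚ.+ eval q
  eval-++ [] q = sym (ℚ.+-identityˡ (eval q))
  eval-++ (t ∷ p) q = trans (cong (term t ℚ.+_) (eval-++ p q)) (sym (ℚ.+-assoc (term t) (eval p) (eval q)))

  eval-map : (g : ℚ × Mono n → ℚ × Mono n) (k : ℚ) → (∀ t → term (g t) ≡ k ℚ.* term t) →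
             ∀ p → eval (map g p) ≡ k ℚ.* eval p
  eval-map g k g-scales [] = sym (ℚ.*-zeroʳ k)
  eval-map g k g-scales (t ∷ p) =
    trans (cong₂ ℚ._+_ (g-scales t) (eval-map g k g-scales p)) (sym (ℚ.*-distribˡ-+ k (term t) (eval p)))

  eval-pscale : ∀ k p → eval (pscale k p) ≡ k ℚ.* eval p
  eval-pscale k = eval-map _ k λ { (c , x) → ℚ.*-assoc k c (evalMono x) }

  eval-pmul : ∀ p q → eval (pmul p q) ≡ eval p ℚ.* eval q
  eval-pmul [] q = sym (ℚ.*-zeroˡ (eval q))
  eval-pmul ((c , x) ∷ p) q = begin
    eval (map _ q ++ pmul p q)                           ≡⟨ eval-++ (map _ q) (pmul p q) ⟩
    eval (map _ q) ℚ.+ eval (pmul p q)                   ≡⟨ cong₂ ℚ._+_ (eval-map _ (term (c , x)) product q)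
                                                                        (eval-pmul p q) ⟩
    term (c , x) ℚ.* eval q ℚ.+ eval p ℚ.* eval q        ≡⟨ ℚ.*-distribʳ-+ (eval q) (term (c , x)) (eval p) ⟨
    (term (c , x) ℚ.+ eval p) ℚ.* eval q                 ∎
    where
    open ≡-Reasoning
    product : ∀ t → term (c ℚ.* proj₁ t , monoMul x (proj₂ t)) ≡ term (c , x) ℚ.* term t
    product (d , y) = trans (cong ((c ℚ.* d) ℚ.*_) (evalMono-monoMul x y)) (interchange c d (evalMono x) (evalMono y))

  eval-pone : eval pone ≡ 1ℚ
  eval-pone = trans (ℚ.+-identityʳ _) (trans (ℚ.*-identityˡ _) evalMono-one)

  eval-pprod-one : ∀ ps → All (λ p → eval p ≡ 1ℚ) ps → eval (pprod ps) ≡ 1ℚ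
  eval-pprod-one [] [] = eval-pone
  eval-pprod-one (p ∷ ps) (p≡1 ∷ ps≡1) =
    trans (eval-pmul p (pprod ps)) (trans (cong₂ ℚ._*_ p≡1 (eval-pprod-one ps ps≡1)) (ℚ.*-identityˡ 1ℚ))

  eval-altSum-zero : ∀ ps → All (λ p → eval p ≡ 0ℚ) ps → eval (altSum ps) ≡ 0ℚ
  eval-altSum-zero [] [] = refl
  eval-altSum-zero (p ∷ ps) (p≡0 ∷ ps≡0) = begin
    eval (p ++ pneg (altSum ps))                ≡⟨ eval-++ p (pneg (altSum ps)) ⟩
    eval p ℚ.+ eval (pneg (altSum ps))          ≡⟨ cong₂ ℚ._+_ p≡0 (eval-pscale (ℚ.- 1ℚ) (altSum ps)) ⟩
    0ℚ ℚ.+ (ℚ.- 1ℚ) ℚ.* eval (altSum ps)        ≡⟨ cong (λ z → 0ℚ ℚ.+ (ℚ.- 1ℚ) ℚ.* z)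
                                                        (eval-altSum-zero ps ps≡0) ⟩
    0ℚ                                          ∎
    where open ≡-Reasoning

  _≟ᴹ_ : DecidableEquality (Mono n)
  _≟ᴹ_ = Vec.≡-dec (Vec.≡-dec ℕ._≟_)

  coeff-here : ∀ c y p → coeff ((c , y) ∷ p) y ≡ c ℚ.+ coeff p y
  coeff-here c y p = cong (λ b → if b then c ℚ.+ coeff p y else coeff p y) (dec-true (y ≟ᴹ y) refl)

  coeff-there : ∀ c y p {x} → y ≢ x → coeff ((c , y) ∷ p) x ≡ coeff p x
  coeff-there c y p {x} y≢x = cong (λ b → if b then c ℚ.+ coeff p x else coeff p x) (dec-false (y ≟ᴹ x) y≢x)

  -- A Poly may repeat a monomial, so evaluation is compared with the coefficients over a
  -- duplicate-free list of monomials.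
  expand : List (Mono n) → Poly n → ℚ
  expand [] p = 0ℚ
  expand (x ∷ U) p = coeff p x ℚ.* evalMono x ℚ.+ expand U p

  expand-cong : ∀ U {p q} → All (λ x → coeff p x ≡ coeff q x) U → expand U p ≡ expand U q
  expand-cong [] [] = refl
  expand-cong (x ∷ U) (px≡qx ∷ p≡q) = cong₂ ℚ._+_ (cong (ℚ._* evalMono x) px≡qx) (expand-cong U p≡q)

  expand-zero : ∀ U p → IsZeroPoly p → expand U p ≡ 0ℚ
  expand-zero [] p p≡0 = refl
  expand-zero (x ∷ U) p p≡0 =
    cong₂ ℚ._+_ (trans (cong (ℚ._* evalMono x) (p≡0 x)) (ℚ.*-zeroˡ (evalMono x))) (expand-zero U p p≡0)

  expand-cons : ∀ {U} c y p → Unique U → y ∈ U → expand U ((c , y) ∷ p) ≡ c ℚ.* evalMono y ℚ.+ expand U p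
  expand-cons {u ∷ U} c u p (u∉U ∷ _) (here refl) = begin
    coeff ((c , u) ∷ p) u ℚ.* evalMono u ℚ.+ expand U ((c , u) ∷ p)
      ≡⟨ cong₂ (λ a s → a ℚ.* evalMono u ℚ.+ s) (coeff-here c u p)
               (expand-cong U (All.map (coeff-there c u p) u∉U)) ⟩
    (c ℚ.+ coeff p u) ℚ.* evalMono u ℚ.+ expand U p
      ≡⟨ cong (ℚ._+ expand U p) (ℚ.*-distribʳ-+ (evalMono u) c (coeff p u)) ⟩
    c ℚ.* evalMono u ℚ.+ coeff p u ℚ.* evalMono u ℚ.+ expand U p
      ≡⟨ ℚ.+-assoc (c ℚ.* evalMono u) _ (expand U p) ⟩
    c ℚ.* evalMono u ℚ.+ (coeff p u ℚ.* evalMono u ℚ.+ expand U p) ∎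
    where open ≡-Reasoning
  expand-cons {u ∷ U} c y p (u∉U ∷ uniq) (there y∈U) = begin
    coeff ((c , y) ∷ p) u ℚ.* evalMono u ℚ.+ expand U ((c , y) ∷ p)
      ≡⟨ cong₂ (λ a s → a ℚ.* evalMono u ℚ.+ s) (coeff-there c y p (All.lookup u∉U y∈U ∘ sym))
               (expand-cons c y p uniq y∈U) ⟩
    coeff p u ℚ.* evalMono u ℚ.+ (c ℚ.* evalMono y ℚ.+ expand U p)
      ≡⟨ x∙yz≈y∙xz (coeff p u ℚ.* evalMono u) (c ℚ.* evalMono y) (expand U p) ⟩
    c ℚ.* evalMono y ℚ.+ (coeff p u ℚ.* evalMono u ℚ.+ expand U p) ∎
    where open ≡-Reasoning

  eval≡expand : ∀ {U} p → Unique U → All (λ t → proj₂ t ∈ U) p → eval p ≡ expand U p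
  eval≡expand {U} [] _ [] = sym (expand-zero U [] (λ _ → refl))
  eval≡expand {U} ((c , y) ∷ p) uniq (y∈U ∷ p⊆U) =
    trans (cong (c ℚ.* evalMono y ℚ.+_) (eval≡expand p uniq p⊆U)) (sym (expand-cons c y p uniq y∈U))

  eval-vanishes : ∀ p → IsZeroPoly p → eval p ≡ 0ℚ
  eval-vanishes p p≡0 =
    trans (eval≡expand p (deduplicate-! _≟ᴹ_ monos) p⊆U) (expand-zero (deduplicate _≟ᴹ_ monos) p p≡0)
    where
    monos : List (Mono n)
    monos = map proj₂ p
    p⊆U : All (λ t → proj₂ t ∈ deduplicate _≟ᴹ_ monos) p
    p⊆U = All.tabulate (λ t∈p → ∈-deduplicate⁺ _≟ᴹ_ (∈-map⁺ proj₂ t∈p))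

  entry : Fin n → Fin n → ℚ
  entry a b = eval (zvarI a b)

  entry-below : ∀ {a b} → b Fin.< a → entry a b ≡ 0ℚ
  entry-below {a} {b} b<a with does (b Fin.<? a) | dec-true (b Fin.<? a) b<a
  ... | _ | refl = refl

  entry-upper : ∀ {a b} → ¬ b Fin.< a → entry a b ≡ v a b
  entry-upper {a} {b} b≮a with does (b Fin.<? a) | dec-false (b Fin.<? a) b≮a
  ... | _ | refl = trans (ℚ.+-identityʳ _) (trans (ℚ.*-identityˡ _) (evalMono-unitMono a b))

  det-zero-column : ∀ as bs {b} → length as ≡ length bs → b ∈ bs → All (λ a → entry a b ≡ 0ℚ) as →
                    eval (detI as bs) ≡ 0ℚ
  det-zero-column [] [] _ () _
  det-zero-column [] (_ ∷ _) () _ _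
  det-zero-column (a ∷ as) bs {b} len b∈bs (ab≡0 ∷ as-b≡0) =
    eval-altSum-zero _ (All.map⁺ (All.map vanishing-term (minors-split bs)))
    where
    vanishing-term : ∀ {xr} → IsSplit bs xr → eval (pmul (zvarI a (proj₁ xr)) (detI as (proj₂ xr))) ≡ 0ℚ
    vanishing-term {x , r} (len-r , split) with x Fin.≟ b | split b∈bs
    ... | yes refl | _ = trans (eval-pmul (zvarI a x) (detI as r))
      (trans (cong (ℚ._* eval (detI as r)) ab≡0) (ℚ.*-zeroˡ (eval (detI as r))))
    ... | no x≢b | inj₁ b≡x = contradiction (sym b≡x) x≢b
    ... | no _ | inj₂ b∈r = trans (eval-pmul (zvarI a x) (detI as r))
      (trans (cong (entry a x ℚ.*_) (det-zero-column as r (suc-injective (trans len (sym len-r))) b∈r as-b≡0))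
             (ℚ.*-zeroʳ (entry a x)))

  data UnitTriangular : List (Fin n) → List (Fin n) → Set where
    [] : UnitTriangular [] []
    pivot : ∀ {a b as bs} → entry a b ≡ 1ℚ → All (λ a′ → entry a′ b ≡ 0ℚ) as → UnitTriangular as bs →
            UnitTriangular (a ∷ as) (b ∷ bs)

  unitTriangular-length : ∀ {as bs} → UnitTriangular as bs → length as ≡ length bs
  unitTriangular-length [] = refl
  unitTriangular-length (pivot _ _ t) = cong suc (unitTriangular-length t)

  det-unitTriangular : ∀ {as bs} → UnitTriangular as bs → eval (detI as bs) ≡ 1ℚ
  det-unitTriangular [] = eval-pone
  det-unitTriangular {a ∷ as} {b ∷ bs} (pivot ab≡1 below≡0 t) = begin
    eval (detI (a ∷ as) (b ∷ bs))
      ≡⟨ eval-++ (pmul (zvarI a b) (detI as bs)) (pneg (altSum others)) ⟩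
    eval (pmul (zvarI a b) (detI as bs)) ℚ.+ eval (pneg (altSum others))
      ≡⟨ cong₂ ℚ._+_ (eval-pmul (zvarI a b) (detI as bs)) (eval-pscale (ℚ.- 1ℚ) (altSum others)) ⟩
    entry a b ℚ.* eval (detI as bs) ℚ.+ (ℚ.- 1ℚ) ℚ.* eval (altSum others)
      ≡⟨ cong₂ (λ x y → x ℚ.+ (ℚ.- 1ℚ) ℚ.* y)
               (trans (cong₂ ℚ._*_ ab≡1 (det-unitTriangular t)) (ℚ.*-identityˡ 1ℚ))
               (eval-altSum-zero others (All.map⁺ (All.map⁺ (All.map vanishing-term (minors-split bs))))) ⟩
    1ℚ ∎
    where
    open ≡-Reasoning
    others : List (Poly n)
    others = map (λ { (x , r) → pmul (zvarI a x) (detI as r) }) (map (λ { (x , r) → (x , b ∷ r) }) (minors bs))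
    vanishing-term : ∀ {xr} → IsSplit bs xr → eval (pmul (zvarI a (proj₁ xr)) (detI as (b ∷ proj₂ xr))) ≡ 0ℚ
    vanishing-term {x , r} (len-r , _) = trans (eval-pmul (zvarI a x) (detI as (b ∷ r)))
      (trans (cong (entry a x ℚ.*_)
                   (det-zero-column as (b ∷ r) (trans (unitTriangular-length t) (sym len-r)) (here refl) below≡0))
             (ℚ.*-zeroʳ (entry a x)))

  unitTriangular-map : (f : Fin n → Fin n) {P : Fin n → Set} →
    (∀ {b} → P b → entry (f b) b ≡ 1ℚ) →
    (∀ {b b′} → P b → P b′ → b Fin.< b′ → entry (f b′) b ≡ 0ℚ) →
    ∀ {bs} → AllPairs Fin._<_ bs → All P bs → UnitTriangular (map f bs) bs
  unitTriangular-map f diagonal below [] [] = []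
  unitTriangular-map f diagonal below (b<bs ∷ sorted) (Pb ∷ Pbs) =
    pivot (diagonal Pb) (All.map⁺ (All.zipWith (λ (Pb′ , b<b′) → below Pb Pb′ b<b′) (Pbs , b<bs)))
          (unitTriangular-map f diagonal below sorted Pbs)

  linIndep-singleton : ∀ p → eval p ≡ 1ℚ → LinIndep (p ∷ [])
  linIndep-singleton p p≡1 [] () _
  linIndep-singleton p p≡1 (_ ∷ _ ∷ _) () _
  linIndep-singleton p p≡1 (c ∷ []) _ combination≡0 = c≡0 ∷ []
    where
    open ≡-Reasoning
    c≡0 : c ≡ 0ℚ
    c≡0 = begin
      c                                      ≡⟨ ℚ.*-identityʳ c ⟨
      c ℚ.* 1ℚ                               ≡⟨ cong (c ℚ.*_) p≡1 ⟨
      c ℚ.* eval p                           ≡⟨ eval-pscale c p ⟨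
      eval (pscale c p)                      ≡⟨ ℚ.+-identityʳ (eval (pscale c p)) ⟨
      eval (pscale c p) ℚ.+ eval []          ≡⟨ eval-++ (pscale c p) [] ⟨
      eval (linComb (c ∷ []) (p ∷ []))       ≡⟨ eval-vanishes (linComb (c ∷ []) (p ∷ [])) combination≡0 ⟩
      0ℚ                                     ∎

-- The raised filling spans a nonzero weight space

colRows-sorted : ∀ {n m} (D : Grid n m) c → AllPairs Fin._<_ (colRows D c)
colRows-sorted D c = AllPairs.filter⁺ (T? ∘ λ r → cell D r c) (AllPairs.tabulate⁺-< λ r<s → r<s)

colRows-cells : ∀ {n m} (D : Grid n m) c → All (λ r → cell D r c ≡ true) (colRows D c)
colRows-cells {n} D c = All.map (Equivalence.to T-≡) (All.all-filter (T? ∘ λ r → cell D r c) (allFin n))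

module _ {n m : ℕ} (D : Grid n m) {i j : Fin n} (i<j : i Fin.< j) where

  raisePoint : Fin n → Fin n → ℚ
  raisePoint a b = if does (a Fin.≟ b) ∨ (does (a Fin.≟ i) ∧ does (b Fin.≟ j)) then 1ℚ else 0ℚ

  open Evaluation raisePoint

  raisePoint-diagonal : ∀ b → raisePoint b b ≡ 1ℚ
  raisePoint-diagonal b = cong (λ d → if d ∨ (does (b Fin.≟ i) ∧ does (b Fin.≟ j)) then 1ℚ else 0ℚ)
                                (dec-true (b Fin.≟ b) refl)

  raisePoint-ij : raisePoint i j ≡ 1ℚ
  raisePoint-ij = cong (λ d → if d then 1ℚ else 0ℚ) (begin
    does (i Fin.≟ j) ∨ (does (i Fin.≟ i) ∧ does (j Fin.≟ j))
      ≡⟨ cong₂ (λ x y → does (i Fin.≟ j) ∨ (x ∧ y)) (dec-true (i Fin.≟ i) refl)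
                                                     (dec-true (j Fin.≟ j) refl) ⟩
    does (i Fin.≟ j) ∨ true
      ≡⟨ ∨-zeroʳ _ ⟩
    true ∎)
    where open ≡-Reasoning

  raisePoint-i : ∀ {b} → i ≢ b → b ≢ j → raisePoint i b ≡ 0ℚ
  raisePoint-i {b} i≢b b≢j
    rewrite dec-false (i Fin.≟ b) i≢b | dec-true (i Fin.≟ i) refl | dec-false (b Fin.≟ j) b≢j = refl

  raise-diagonal : ∀ {c b} → cell D b c ≡ true → entry (raise D i j b c) b ≡ 1ℚ
  raise-diagonal {c} {b} _ with b Fin.≟ j | cell D i c
  ... | yes refl | false = trans (entry-upper (<⇒≯ i<j)) raisePoint-ij
  ... | yes _ | true = trans (entry-upper {b} {b} (<-irrefl refl)) (raisePoint-diagonal b)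
  ... | no _ | _ = trans (entry-upper {b} {b} (<-irrefl refl)) (raisePoint-diagonal b)

  raise-below : ∀ {c b b′} → cell D b c ≡ true → cell D b′ c ≡ true → b Fin.< b′ →
                entry (raise D i j b′ c) b ≡ 0ℚ
  raise-below {c} {b} {b′} bc∈D _ b<b′ with b′ Fin.≟ j | cell D i c in ic
  ... | yes _ | true = entry-below b<b′
  ... | no _ | _ = entry-below b<b′
  ... | yes refl | false with b Fin.<? i
  ...   | yes b<i = entry-below b<i
  ...   | no b≮i = trans (entry-upper b≮i) (raisePoint-i i≢b (λ { refl → <-irrefl refl b<b′ }))
    where
    i≢b : i ≢ b
    i≢b refl = contradiction (trans (sym bc∈D) ic) λ ()

  eval-ΔI-raise : eval (ΔI D (raise D i j)) ≡ 1ℚ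
  eval-ΔI-raise = eval-pprod-one _ (All.map⁺ (All.tabulate⁺ λ c →
    det-unitTriangular (unitTriangular-map (λ r → raise D i j r c) raise-diagonal raise-below
                                           (colRows-sorted D c) (colRows-cells D c))))

  ΔI-raise-linIndep : LinIndep (ΔI D (raise D i j) ∷ [])
  ΔI-raise-linIndep = linIndep-singleton (ΔI D (raise D i j)) eval-ΔI-raise

module _ {n m : ℕ} (D : Grid n m) {α : Vec ℕ n} {k : ℕ} where

  weightDim-nonzero : (F : Filling n m) → content D F ≡ α → LinIndep (ΔI D F ∷ []) → WeightDim D α k → k ≢ 0
  weightDim-nonzero F F≡α independent (_ , maximal) refl = maximal (F ∷ []) refl (F≡α ∷ []) independent

  kohnertCoeff-zero : (∀ {T} → KD D T → wt T ≢ α) → KohnertCoeff D α k → k ≡ 0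
  kohnertCoeff-zero none ([] , _ , _ , length≡k) = sym length≡k
  kohnertCoeff-zero none (T ∷ _ , _ , members , _) = ⊥-elim (uncurry none (Equivalence.to (members T) (here refl)))

theorem4p15 : (n m : ℕ) (D : Grid n m) →
    PercentAvoiding D → ¬ Northwest D → ¬ CharEqKohnert D
theorem4p15 n m D %-avoiding ¬northwest charEq
  with covered-violation D (violation-of-¬northwest D ¬northwest) (<-wellFounded _)
... | i , j , k , l , violation , covered with charEq (content D (raise D i j))
... | _ , dim , coeff =
  weightDim-nonzero D (raise D i j) refl nonzero-weight-vector dim (kohnertCoeff-zero D no-kohnert-diagram coeff)
  where
  nonzero-weight-vector : LinIndep (ΔI D (raise D i j) ∷ [])
  nonzero-weight-vector = ΔI-raise-linIndep D (NWViolation.i<j violation)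
  no-kohnert-diagram : ∀ {T} → KD D T → wt T ≢ content D (raise D i j)
  no-kohnert-diagram =
    NoKohnertDiagram.no-kohnert-diagram D violation (%-avoiding⇒jl∈D D %-avoiding violation) covered
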